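{- Let $n\geq 3$ be an integer. Then $\#\mathcal F_n=(n^2-3n+4)/2$; $\#\mathcal F_n^+=(n^2-2n+5)/4$ if $n$ is odd and $\#\mathcal F_n^+=(n^2-2n+4)/4$ if $n$ is even; and $\#(\mathcal F_n^+\times\mathcal T_n)=(n^3-3n^2+7n-5)/4$ if $n$ is odd and $(n^3-3n^2+6n-4)/4$ if $n$ is even.
   Context: $f_n$ denotes the Fibonacci sequence: $f_0=0$, $f_1=1$, $f_n=f_{n-1}+f_{n-2}$ for $n\geq 2$. For integers $1\leq k<\ell\leq n$, ${\bf y}_n(k,\ell)=(y_1,\ldots,y_n)^T\in\mathbb R^n$ has $y_k=(-1)^{\ell-k+1}f_{n-\ell}/f_{\ell-k}$, $y_\ell=f_{n-k}/f_{\ell-k}$, and $y_i=0$ for $i\notin\{k,\ell\}$. $\mathcal F_n=\{{\bf y}_n(k,\ell):1\leq k<\ell\leq n\}$ and $\mathcal F_n^+=\{{\bf y}_n(k,\ell):1\leq k<\ell\leq n,\ \ell-k\text{ odd}\}$ (sets of vectors, so coinciding vectors are counted once). $\mathcal T_n=\{t_1,\ldots,t_{n-1}\}$ where $t_1>t_2>\cdots>t_{n-1}$ are positive real numbers. -}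

module Defs where

open import Data.Nat using (ℕ; zero; suc; _+_; _∸_; _≤_; _<_)
open import Data.Nat.Properties using (_≟_)
open import Data.Integer as ℤ using (ℤ; +_; -_)
open import Data.Rational using (ℚ; 0ℚ; _/_)
open import Data.Fin using (Fin; toℕ)
open import Data.Vec using (Vec; tabulate)
open import Data.List using (List; length)
open import Data.List.Membership.Propositional using (_∈_)
open import Data.List.Relation.Unary.Unique.Propositional using (Unique)
open import Data.Product using (Σ; ∃; ∃-syntax; _×_)
open import Function.Bundles using (_⇔_)
open import Relation.Binary.PropositionalEquality using (_≡_)
open import Relation.Nullary using (yes; no)
open import Data.Nat.Base using (_%_)

fib : ℕ → ℕ
fib zero = 0
fib (suc zero) = 1
fib (suc (suc n)) = fib (suc n) + fib n

sgn : ℕ → ℤ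
sgn zero = + 1
sgn (suc m) = - sgn m

-- a / d as a rational; only used with d = f (ℓ - k) ≥ 1 (ℓ > k), where it is the
-- genuine quotient (the d = 0 branch is a never-used default).
frac : ℤ → ℕ → ℚ
frac a zero = 0ℚ
frac a (suc d) = a / suc d

-- y_n(k,ℓ) ∈ ℚ^n ⊆ ℝ^n (1-based coordinates: position i : Fin n is coordinate toℕ i + 1)
--   y_k = (-1)^(ℓ-k+1) f_{n-ℓ} / f_{ℓ-k},  y_ℓ = f_{n-k} / f_{ℓ-k},  other coordinates 0.
yvec : (n k ℓ : ℕ) → Vec ℚ n
yvec n k ℓ = tabulate coord
  where
  coord : Fin n → ℚ
  coord i with suc (toℕ i) ≟ k | suc (toℕ i) ≟ ℓ
  ... | yes _ | _     = frac (sgn (suc (ℓ ∸ k)) ℤ.* (+ fib (n ∸ ℓ))) (fib (ℓ ∸ k))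
  ... | no _  | yes _ = frac (+ fib (n ∸ k)) (fib (ℓ ∸ k))
  ... | no _  | no _  = 0ℚ

InF : (n : ℕ) → Vec ℚ n → Set
InF n v = ∃[ k ] ∃[ ℓ ] (1 ≤ k × k < ℓ × ℓ ≤ n × v ≡ yvec n k ℓ)

InF⁺ : (n : ℕ) → Vec ℚ n → Set
InF⁺ n v = ∃[ k ] ∃[ ℓ ] (1 ≤ k × k < ℓ × ℓ ≤ n × (ℓ ∸ k) % 2 ≡ 1 × v ≡ yvec n k ℓ)

HasCard : {A : Set} → (A → Set) → ℕ → Set
HasCard {A} P m = Σ (List A) λ L → Unique L × (∀ x → (x ∈ L) ⇔ P x) × length L ≡ m

{-# OPTIONS --safe #-}
-- For ℓ < n the coordinates y_k and y_ℓ of y_n(k,ℓ) are nonzero (f_{n-ℓ}, f_{n-k}, f_{ℓ-k} > 0),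
-- so its support is exactly {k, ℓ} and these vectors are pairwise distinct; for ℓ = n the
-- k-th coordinate is ±f_0/f_{n-k} = 0 and the n-th is 1, so every y_n(k,n) is the last unit
-- vector. Hence, for a condition P on ℓ - k that holds for ℓ - k = 1, the number of vectors is
-- one more than the number c(n-1) of pairs 1 ≤ k < ℓ ≤ n-1 with P(ℓ - k). Splitting off the
-- pairs with k = 1 gives c(m+1) = #{1 ≤ d ≤ m : P d} + c(m), so c(m) = m(m-1)/2 without
-- condition and c(m) = ⌊m/2⌋⌈m/2⌉ for odd differences. The t_i are distinct, so the product
-- has (n-1)·#𝓕_n^+ elements.
module Submission where

open import Defs
open import Data.Nat using (ℕ; _+_; _*_; _∸_; _≤_)
open import Data.Nat.Base using (_%_)
open import Data.Rational using (ℚ)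
open import Data.Vec using (Vec)
open import Data.Fin as Fin using (Fin)
open import Data.Product using (_×_; _,_; ∃-syntax)
open import Relation.Binary.PropositionalEquality using (_≡_)
open import Relation.Nullary using (¬_)

open import Level using (0ℓ)
open import Data.Nat.Base using (zero; suc; _<_; z≤n; s≤s; ⌊_/2⌋; ⌈_/2⌉)
open import Data.Nat.Properties
  using (_≟_; <⇒≤; ≤-pred; ≤-refl; ≤-trans; <-trans; <-irrefl; n<1+n; m≤n⇒m≤1+n; m≤n⇒m<n∨m≡n; m<n⇒0<n∸m;
         m+n∸n≡m; m≤m+n; n∸n≡0; +-assoc; ⌊n/2⌋+⌈n/2⌉≡n)
open import Data.Nat.Tactic.RingSolver using (solve; solve-∀)
open import Data.Integer as ℤ using (+_; -_; 0ℤ)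
open import Data.Integer.GCD using (gcd)
open import Data.Integer.Properties using (neg-involutive; *-comm; *-zeroʳ; i*j≡0⇒i≡0∨j≡0)
open import Data.Rational using (0ℚ; 1ℚ; _/_)
open import Data.Rational.Properties using (↥-/; p≡0⇒↥p≡0; 0/n≡0; fromℚᵘ-cong)
open import Data.Rational.Unnormalised.Base using (mkℚᵘ; *≡*)
open import Data.Fin using (toℕ; fromℕ<)
open import Data.Fin.Properties using (toℕ-fromℕ<; <-cmp)
open import Data.Vec using (lookup)
open import Data.Vec.Properties using (lookup∘tabulate; tabulate∘lookup; tabulate-cong)
open import Data.List using (List; []; _∷_; _++_; map; length; tabulate; cartesianProduct)
open import Data.List.Properties using (length-++; length-map; length-tabulate)
open import Data.List.Membership.Propositional using (_∈_)
open import Data.List.Membership.Propositional.Properties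
  using (∈-map⁺; ∈-map⁻; ∈-++⁺ˡ; ∈-++⁺ʳ; ∈-++⁻; ∈-tabulate⁺; ∈-tabulate⁻; ∈-cartesianProduct⁺; ∈-cartesianProduct⁻)
open import Data.List.Relation.Unary.Any using (here; there)
import Data.List.Relation.Unary.All as All
open import Data.List.Relation.Unary.All.Properties using () renaming (map⁺ to All-map⁺)
open import Data.List.Relation.Unary.Unique.Propositional using (Unique; []; _∷_)
import Data.List.Relation.Unary.Unique.Propositional.Properties as Unique
open import Data.Product using (proj₂; uncurry)
open import Data.Sum using (_⊎_; inj₁; inj₂) renaming (map to map-⊎)
open import Function using (_∘_; case_of_)
open import Data.Empty using (⊥-elim)
open import Function.Bundles using (mk⇔; _⇔_; Equivalence)
open import Relation.Binary.Definitions using (tri<; tri≈; tri>)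
open import Relation.Binary.PropositionalEquality using (refl; sym; trans; cong; cong₂; subst; _≢_; module ≡-Reasoning)
open import Relation.Nullary using (yes; no; contradiction)
open import Relation.Unary using (Pred; U; ｛_｝; _∪_; _⊆_; _≐_; _⊥_; _⟨×⟩_)

open Equivalence using (to; from)

module _ {A : Set} where

  hasCard-≐ : {P Q : Pred A 0ℓ} {m : ℕ} → P ≐ Q → HasCard P m → HasCard Q m
  hasCard-≐ (P⊆Q , Q⊆P) (xs , unique , mem , len) =
    xs , unique , (λ x → mk⇔ (P⊆Q ∘ to (mem x)) (from (mem x) ∘ Q⊆P)) , len

  hasCard-∅ : {P : Pred A 0ℓ} → (∀ x → ¬ P x) → HasCard P 0
  hasCard-∅ ∉P = [] , [] , (λ x → mk⇔ (λ ()) (⊥-elim ∘ ∉P x)) , refl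

  hasCard-｛｝ : (a : A) → HasCard ｛ a ｝ 1
  hasCard-｛｝ a = a ∷ [] , All.[] ∷ [] , mem , refl
    where
    mem : ∀ x → x ∈ a ∷ [] ⇔ ｛ a ｝ x
    mem x = mk⇔ (λ { (here x≡a) → sym x≡a ; (there ()) }) (here ∘ sym)

  hasCard-∪ : {P Q : Pred A 0ℓ} {a b : ℕ} → P ⊥ Q → HasCard P a → HasCard Q b → HasCard (P ∪ Q) (a + b)
  hasCard-∪ {P} {Q} P⊥Q (xs , uxs , xs↔P , refl) (ys , uys , ys↔Q , refl) =
    xs ++ ys , Unique.++⁺ uxs uys disjoint , mem , length-++ xs
    where
    disjoint : ∀ {x} → ¬ (x ∈ xs × x ∈ ys)
    disjoint {x} (x∈xs , x∈ys) = P⊥Q (to (xs↔P x) x∈xs , to (ys↔Q x) x∈ys)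
    mem : ∀ x → x ∈ xs ++ ys ⇔ (P ∪ Q) x
    mem x = mk⇔ (λ x∈ → map-⊎ (to (xs↔P x)) (to (ys↔Q x)) (∈-++⁻ xs x∈))
                (λ { (inj₁ p) → ∈-++⁺ˡ (from (xs↔P x) p) ; (inj₂ q) → ∈-++⁺ʳ xs (from (ys↔Q x) q) })

module _ {A B : Set} where

  Image : (A → B) → Pred A 0ℓ → Pred B 0ℓ
  Image f P y = ∃[ x ] (P x × y ≡ f x)

  unique-map : (f : A → B) {xs : List A} → (∀ {x y} → x ∈ xs → y ∈ xs → f x ≡ f y → x ≡ y) →
               Unique xs → Unique (map f xs)
  unique-map f inj [] = []
  unique-map f inj (x∉xs ∷ unique) =
    All-map⁺ (All.tabulate (λ y∈xs fx≡fy → All.lookup x∉xs y∈xs (inj (here refl) (there y∈xs) fx≡fy)))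
    ∷ unique-map f (λ x∈ y∈ → inj (there x∈) (there y∈)) unique

  hasCard-Image : {P : Pred A 0ℓ} {m : ℕ} (f : A → B) → (∀ {x y} → P x → P y → f x ≡ f y → x ≡ y) →
                  HasCard P m → HasCard (Image f P) m
  hasCard-Image {P} f inj (xs , unique , xs↔P , refl) =
    map f xs , unique-map f (λ x∈ y∈ → inj (to (xs↔P _) x∈) (to (xs↔P _) y∈)) unique , mem , length-map f xs
    where
    mem : ∀ y → y ∈ map f xs ⇔ Image f P y
    mem y = mk⇔ (λ y∈ → let (x , x∈ , y≡fx) = ∈-map⁻ f y∈ in x , to (xs↔P x) x∈ , y≡fx)
                (λ { (x , p , refl) → ∈-map⁺ f (from (xs↔P x) p) })

  length-cartesianProduct : (xs : List A) (ys : List B) → length (cartesianProduct xs ys) ≡ length xs * length ys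
  length-cartesianProduct [] ys = refl
  length-cartesianProduct (x ∷ xs) ys =
    trans (length-++ (map (x ,_) ys)) (cong₂ _+_ (length-map (x ,_) ys) (length-cartesianProduct xs ys))

  hasCard-⟨×⟩ : {P : Pred A 0ℓ} {Q : Pred B 0ℓ} {a b : ℕ} → HasCard P a → HasCard Q b → HasCard (P ⟨×⟩ Q) (a * b)
  hasCard-⟨×⟩ {P} {Q} (xs , uxs , xs↔P , refl) (ys , uys , ys↔Q , refl) =
    cartesianProduct xs ys , Unique.cartesianProduct⁺ uxs uys , mem , length-cartesianProduct xs ys
    where
    mem : ∀ z → z ∈ cartesianProduct xs ys ⇔ (P ⟨×⟩ Q) z
    mem (x , y) = mk⇔ (λ z∈ → let (x∈ , y∈) = ∈-cartesianProduct⁻ xs ys z∈ in to (xs↔P x) x∈ , to (ys↔Q y) y∈)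
                      (λ (p , q) → ∈-cartesianProduct⁺ (from (xs↔P x) p) (from (ys↔Q y) q))

hasCard-range : {A : Set} {m : ℕ} (t : Fin m → A) → (∀ {i j} → t i ≡ t j → i ≡ j) →
                HasCard (λ a → ∃[ i ] (a ≡ t i)) m
hasCard-range t inj =
  tabulate t , Unique.tabulate⁺ inj , (λ a → mk⇔ ∈-tabulate⁻ λ { (i , refl) → ∈-tabulate⁺ i }) , length-tabulate t

fib-pos : ∀ {d} → 0 < d → 0 < fib d
fib-pos {suc zero} _ = s≤s z≤n
fib-pos {suc (suc d)} _ = ≤-trans (fib-pos {suc d} (s≤s z≤n)) (m≤m+n (fib (suc d)) (fib d))

sgn-≢0 : ∀ s → sgn s ≢ 0ℤ
sgn-≢0 zero ()
sgn-≢0 (suc s) sgn≡0 = sgn-≢0 s (trans (sym (neg-involutive (sgn s))) (cong -_ sgn≡0))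

sgn*-≢0 : ∀ s {x} → 0 < x → sgn s ℤ.* + x ≢ 0ℤ
sgn*-≢0 s {suc x} _ eq with i*j≡0⇒i≡0∨j≡0 (sgn s) eq
... | inj₁ sgn≡0 = sgn-≢0 s sgn≡0
... | inj₂ ()

frac-≢0 : ∀ {a c} → 0 < c → a ≢ 0ℤ → frac a c ≢ 0ℚ
frac-≢0 {a} {suc c} _ a≢0 a/c≡0 =
  a≢0 (trans (sym (↥-/ a (suc c))) (cong (ℤ._* gcd a (+ suc c)) (p≡0⇒↥p≡0 (a / suc c) a/c≡0)))

frac-0 : ∀ c → frac 0ℤ c ≡ 0ℚ
frac-0 zero = refl
frac-0 (suc c) = 0/n≡0 (suc c)

frac-self : ∀ {c} → 0 < c → frac (+ c) c ≡ 1ℚ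
frac-self {suc c} _ = fromℚᵘ-cong {mkℚᵘ (+ suc c) c} {mkℚᵘ (+ 1) 0} (*≡* (*-comm (+ suc c) (+ 1)))

lookup-ext : ∀ {A : Set} {n} {v w : Vec A n} → (∀ i → lookup v i ≡ lookup w i) → v ≡ w
lookup-ext {v = v} {w} v≗w = trans (sym (tabulate∘lookup v)) (trans (tabulate-cong v≗w) (tabulate∘lookup w))

module _ {n k ℓ : ℕ} (i : Fin n) where

  private
    lookup-yvec : lookup (yvec n k ℓ) i ≡ _
    lookup-yvec = lookup∘tabulate _ i

  lookup-yvec-first : suc (toℕ i) ≡ k →
                      lookup (yvec n k ℓ) i ≡ frac (sgn (suc (ℓ ∸ k)) ℤ.* + fib (n ∸ ℓ)) (fib (ℓ ∸ k))
  lookup-yvec-first i≡k rewrite lookup-yvec with suc (toℕ i) ≟ k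
  ... | yes _ = refl
  ... | no i≢k = contradiction i≡k i≢k

  lookup-yvec-second : k < ℓ → suc (toℕ i) ≡ ℓ → lookup (yvec n k ℓ) i ≡ frac (+ fib (n ∸ k)) (fib (ℓ ∸ k))
  lookup-yvec-second k<ℓ i≡ℓ rewrite lookup-yvec with suc (toℕ i) ≟ k | suc (toℕ i) ≟ ℓ
  ... | yes i≡k | _ = ⊥-elim (<-irrefl (trans (sym i≡k) i≡ℓ) k<ℓ)
  ... | no _ | yes _ = refl
  ... | no _ | no i≢ℓ = contradiction i≡ℓ i≢ℓ

  lookup-yvec-other : suc (toℕ i) ≢ k → suc (toℕ i) ≢ ℓ → lookup (yvec n k ℓ) i ≡ 0ℚ
  lookup-yvec-other i≢k i≢ℓ rewrite lookup-yvec with suc (toℕ i) ≟ k | suc (toℕ i) ≟ ℓ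
  ... | yes i≡k | _ = contradiction i≡k i≢k
  ... | no _ | yes i≡ℓ = contradiction i≡ℓ i≢ℓ
  ... | no _ | no _ = refl

Support : ∀ {n} → Vec ℚ n → Pred ℕ 0ℓ
Support v j = ∃[ i ] (suc (toℕ i) ≡ j × lookup v i ≢ 0ℚ)

position : ∀ {n j} → 1 ≤ j → j ≤ n → ∃[ i ] (suc (toℕ {n} i) ≡ j)
position {j = suc j} _ j<n = fromℕ< j<n , cong suc (toℕ-fromℕ< j<n)

support-yvec : ∀ {n k ℓ j} → Support (yvec n k ℓ) j → j ≡ k ⊎ j ≡ ℓ
support-yvec (i , refl , y≢0) with suc (toℕ i) ≟ _ | suc (toℕ i) ≟ _
... | yes i≡k | _ = inj₁ i≡k
... | no _ | yes i≡ℓ = inj₂ i≡ℓ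
... | no i≢k | no i≢ℓ = contradiction (lookup-yvec-other i i≢k i≢ℓ) y≢0

+-≢0 : ∀ {x} → 0 < x → + x ≢ 0ℤ
+-≢0 {suc x} _ ()

first∈support : ∀ {n k ℓ} → 1 ≤ k → k < ℓ → ℓ < n → Support (yvec n k ℓ) k
first∈support {n} {k} {ℓ} 1≤k k<ℓ ℓ<n with position 1≤k (<⇒≤ (<-trans k<ℓ ℓ<n))
... | i , i≡k = i , i≡k , subst (_≢ 0ℚ) (sym (lookup-yvec-first i i≡k))
  (frac-≢0 (fib-pos (m<n⇒0<n∸m k<ℓ)) (sgn*-≢0 (suc (ℓ ∸ k)) (fib-pos (m<n⇒0<n∸m ℓ<n))))

second∈support : ∀ {n k ℓ} → k < ℓ → ℓ ≤ n → Support (yvec n k ℓ) ℓ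
second∈support k<ℓ ℓ≤n with position (≤-trans (s≤s z≤n) k<ℓ) ℓ≤n
... | i , i≡ℓ = i , i≡ℓ , subst (_≢ 0ℚ) (sym (lookup-yvec-second i k<ℓ i≡ℓ))
  (frac-≢0 (fib-pos (m<n⇒0<n∸m k<ℓ)) (+-≢0 (fib-pos (m<n⇒0<n∸m (≤-trans k<ℓ ℓ≤n)))))

sorted-pairs-≡ : ∀ {k ℓ k' ℓ'} → k < ℓ → k' < ℓ' →
                 k ≡ k' ⊎ k ≡ ℓ' → ℓ ≡ k' ⊎ ℓ ≡ ℓ' → k' ≡ k ⊎ k' ≡ ℓ → (k , ℓ) ≡ (k' , ℓ')
sorted-pairs-≡ k<ℓ k'<ℓ' (inj₁ refl) (inj₂ refl) _ = refl
sorted-pairs-≡ k<ℓ k'<ℓ' (inj₁ refl) (inj₁ refl) _ = ⊥-elim (<-irrefl refl k<ℓ)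
sorted-pairs-≡ k<ℓ k'<ℓ' (inj₂ refl) _ (inj₁ refl) = ⊥-elim (<-irrefl refl k'<ℓ')
sorted-pairs-≡ k<ℓ k'<ℓ' (inj₂ refl) _ (inj₂ refl) = ⊥-elim (<-irrefl refl (<-trans k<ℓ k'<ℓ'))

yvec-injective : ∀ {n k ℓ k' ℓ'} → 1 ≤ k → k < ℓ → ℓ < n → 1 ≤ k' → k' < ℓ' → ℓ' < n →
                 yvec n k ℓ ≡ yvec n k' ℓ' → (k , ℓ) ≡ (k' , ℓ')
yvec-injective 1≤k k<ℓ ℓ<n 1≤k' k'<ℓ' ℓ'<n y≡y' = sorted-pairs-≡ k<ℓ k'<ℓ'
  (support-yvec (subst (λ v → Support v _) y≡y' (first∈support 1≤k k<ℓ ℓ<n)))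
  (support-yvec (subst (λ v → Support v _) y≡y' (second∈support k<ℓ (<⇒≤ ℓ<n))))
  (support-yvec (subst (λ v → Support v _) (sym y≡y') (first∈support 1≤k' k'<ℓ' ℓ'<n)))

yvec-≢-last : ∀ {n k ℓ k'} → k < ℓ → ℓ < n → k' < n → yvec n k ℓ ≢ yvec n k' n
yvec-≢-last {n} {k} {ℓ} k<ℓ ℓ<n k'<n y≡e
  with support-yvec {k = k} {ℓ} (subst (λ v → Support v n) (sym y≡e) (second∈support k'<n ≤-refl))
... | inj₁ refl = <-irrefl refl (<-trans k<ℓ ℓ<n)
... | inj₂ refl = <-irrefl refl ℓ<n

module _ {n k : ℕ} (k<n : k < n) (i : Fin n) where

  lookup-yvec-last-at : suc (toℕ i) ≡ n → lookup (yvec n k n) i ≡ 1ℚ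
  lookup-yvec-last-at i≡n =
    trans (lookup-yvec-second i k<n i≡n) (frac-self (fib-pos (m<n⇒0<n∸m k<n)))

  lookup-yvec-last-off : suc (toℕ i) ≢ n → lookup (yvec n k n) i ≡ 0ℚ
  lookup-yvec-last-off i≢n with suc (toℕ i) ≟ k
  ... | no i≢k = lookup-yvec-other i i≢k i≢n
  ... | yes i≡k = begin
    lookup (yvec n k n) i                                  ≡⟨ lookup-yvec-first i i≡k ⟩
    frac (sgn (suc (n ∸ k)) ℤ.* + fib (n ∸ n)) (fib (n ∸ k)) ≡⟨ cong (λ a → frac a (fib (n ∸ k))) y-first≡0 ⟩
    frac 0ℤ (fib (n ∸ k))                                    ≡⟨ frac-0 (fib (n ∸ k)) ⟩
    0ℚ                                                       ∎
    where
    open ≡-Reasoning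
    y-first≡0 : sgn (suc (n ∸ k)) ℤ.* + fib (n ∸ n) ≡ 0ℤ
    y-first≡0 rewrite n∸n≡0 n = *-zeroʳ (sgn (suc (n ∸ k)))

yvec-last-≡ : ∀ {n k k'} → k < n → k' < n → yvec n k n ≡ yvec n k' n
yvec-last-≡ {n} k<n k'<n = lookup-ext λ i → case suc (toℕ i) ≟ n of λ where
  (yes i≡n) → trans (lookup-yvec-last-at k<n i i≡n) (sym (lookup-yvec-last-at k'<n i i≡n))
  (no i≢n) → trans (lookup-yvec-last-off k<n i i≢n) (sym (lookup-yvec-last-off k'<n i i≢n))

IsIndicator : Pred ℕ 0ℓ → (ℕ → ℕ) → Set
IsIndicator P χ = ∀ d → (χ d ≡ 1 × P d) ⊎ (χ d ≡ 0 × ¬ P d)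

Diffs : Pred ℕ 0ℓ → ℕ → Pred ℕ 0ℓ
Diffs P j d = 1 ≤ d × d ≤ j × P d

Pairs : Pred ℕ 0ℓ → ℕ → Pred (ℕ × ℕ) 0ℓ
Pairs P m (k , ℓ) = 1 ≤ k × k < ℓ × ℓ ≤ m × P (ℓ ∸ k)

diffCount : (ℕ → ℕ) → ℕ → ℕ
diffCount χ zero = 0
diffCount χ (suc j) = χ (suc j) + diffCount χ j

pairCount : (ℕ → ℕ) → ℕ → ℕ
pairCount χ zero = 0
pairCount χ (suc j) = diffCount χ j + pairCount χ j

module _ {P : Pred ℕ 0ℓ} {j : ℕ} where

  Diffs-suc⊆ : Diffs P (suc j) ⊆ ｛ suc j ｝ ∪ Diffs P j
  Diffs-suc⊆ (1≤d , d≤1+j , p) with m≤n⇒m<n∨m≡n d≤1+j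
  ... | inj₁ d<1+j = inj₂ (1≤d , ≤-pred d<1+j , p)
  ... | inj₂ d≡1+j = inj₁ (sym d≡1+j)

  Diffs-weaken : Diffs P j ⊆ Diffs P (suc j)
  Diffs-weaken (1≤d , d≤j , p) = 1≤d , m≤n⇒m≤1+n d≤j , p

  Diffs-suc-with : P (suc j) → ｛ suc j ｝ ∪ Diffs P j ≐ Diffs P (suc j)
  Diffs-suc-with p = (λ { (inj₁ refl) → s≤s z≤n , ≤-refl , p ; (inj₂ d∈) → Diffs-weaken d∈ }) , Diffs-suc⊆

  Diffs-suc-without : ¬ P (suc j) → Diffs P j ≐ Diffs P (suc j)
  Diffs-suc-without ¬p = Diffs-weaken , λ d∈ → case Diffs-suc⊆ d∈ of λ where
    (inj₁ refl) → ⊥-elim (¬p (proj₂ (proj₂ d∈)))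
    (inj₂ d∈′) → d∈′

hasCard-Diffs : ∀ {P χ} → IsIndicator P χ → ∀ j → HasCard (Diffs P j) (diffCount χ j)
hasCard-Diffs χ-ind zero = hasCard-∅ λ { _ (s≤s _ , () , _) }
hasCard-Diffs {P} {χ} χ-ind (suc j) with χ-ind (suc j)
... | inj₁ (χ≡1 , p) = subst (λ c → HasCard (Diffs P (suc j)) (c + diffCount χ j)) (sym χ≡1)
  (hasCard-≐ (Diffs-suc-with p) (hasCard-∪ (λ { (refl , _ , 1+j≤j , _) → <-irrefl refl 1+j≤j })
                                          (hasCard-｛｝ (suc j)) (hasCard-Diffs χ-ind j)))
... | inj₂ (χ≡0 , ¬p) = subst (λ c → HasCard (Diffs P (suc j)) (c + diffCount χ j)) (sym χ≡0)
  (hasCard-≐ (Diffs-suc-without ¬p) (hasCard-Diffs χ-ind j))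

start : ℕ → ℕ × ℕ
start d = 1 , suc d

shift : ℕ × ℕ → ℕ × ℕ
shift (k , ℓ) = suc k , suc ℓ

module _ {P : Pred ℕ 0ℓ} {j : ℕ} where

  Pairs-suc : Image start (Diffs P j) ∪ Image shift (Pairs P j) ≐ Pairs P (suc j)
  Pairs-suc = split⁻¹ , split
    where
    split⁻¹ : Image start (Diffs P j) ∪ Image shift (Pairs P j) ⊆ Pairs P (suc j)
    split⁻¹ (inj₁ (d , (1≤d , d≤j , p) , refl)) = s≤s z≤n , s≤s 1≤d , s≤s d≤j , p
    split⁻¹ (inj₂ (_ , (1≤k , k<ℓ , ℓ≤j , p) , refl)) = s≤s z≤n , s≤s k<ℓ , s≤s ℓ≤j , p
    split : Pairs P (suc j) ⊆ Image start (Diffs P j) ∪ Image shift (Pairs P j)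
    split {suc zero , suc d} (_ , s≤s 1≤d , s≤s d≤j , p) = inj₁ (d , (1≤d , d≤j , p) , refl)
    split {suc (suc k) , suc ℓ} (_ , s≤s k<ℓ , s≤s ℓ≤j , p) = inj₂ ((suc k , ℓ) , (s≤s z≤n , k<ℓ , ℓ≤j , p) , refl)

  start⊥shift : Image start (Diffs P j) ⊥ Image shift (Pairs P j)
  start⊥shift ((_ , _ , refl) , (_ , (() , _) , refl))

hasCard-Pairs : ∀ {P χ} → IsIndicator P χ → ∀ m → HasCard (Pairs P m) (pairCount χ m)
hasCard-Pairs χ-ind zero = hasCard-∅ λ { _ (_ , s≤s _ , () , _) }
hasCard-Pairs χ-ind (suc j) = hasCard-≐ Pairs-suc (hasCard-∪ start⊥shift
  (hasCard-Image start (λ { _ _ refl → refl }) (hasCard-Diffs χ-ind j))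
  (hasCard-Image shift (λ { _ _ refl → refl }) (hasCard-Pairs χ-ind j)))

InF[_] : Pred ℕ 0ℓ → (n : ℕ) → Pred (Vec ℚ n) 0ℓ
InF[ P ] n v = ∃[ k ] ∃[ ℓ ] (1 ≤ k × k < ℓ × ℓ ≤ n × P (ℓ ∸ k) × v ≡ yvec n k ℓ)

module _ {P : Pred ℕ 0ℓ} {m : ℕ} where

  private
    n : ℕ
    n = suc m
    y : ℕ × ℕ → Vec ℚ n
    y = uncurry (yvec n)
    e : Vec ℚ n
    e = yvec n m n

  InF-decomposition : P 1 → 1 ≤ m → Image y (Pairs P m) ∪ ｛ e ｝ ≐ InF[ P ] n
  InF-decomposition P1 1≤m = join , split
    where
    join : Image y (Pairs P m) ∪ ｛ e ｝ ⊆ InF[ P ] n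
    join (inj₁ ((k , ℓ) , (1≤k , k<ℓ , ℓ≤m , p) , refl)) = k , ℓ , 1≤k , k<ℓ , m≤n⇒m≤1+n ℓ≤m , p , refl
    join (inj₂ refl) = m , n , 1≤m , n<1+n m , ≤-refl , subst P (sym (m+n∸n≡m 1 m)) P1 , refl
    split : InF[ P ] n ⊆ Image y (Pairs P m) ∪ ｛ e ｝
    split (k , ℓ , 1≤k , k<ℓ , ℓ≤n , p , refl) with m≤n⇒m<n∨m≡n ℓ≤n
    ... | inj₁ ℓ<n = inj₁ ((k , ℓ) , (1≤k , k<ℓ , ≤-pred ℓ<n , p) , refl)
    ... | inj₂ refl = inj₂ (yvec-last-≡ (n<1+n m) k<ℓ)

  yvec-injectiveOn-Pairs : ∀ {p q} → Pairs P m p → Pairs P m q → y p ≡ y q → p ≡ q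
  yvec-injectiveOn-Pairs (1≤k , k<ℓ , ℓ≤m , _) (1≤k' , k'<ℓ' , ℓ'≤m , _) =
    yvec-injective 1≤k k<ℓ (s≤s ℓ≤m) 1≤k' k'<ℓ' (s≤s ℓ'≤m)

  Image⊥last : Image y (Pairs P m) ⊥ ｛ e ｝
  Image⊥last ((_ , (_ , k<ℓ , ℓ≤m , _) , refl) , e≡y) = yvec-≢-last k<ℓ (s≤s ℓ≤m) (n<1+n m) (sym e≡y)

hasCard-InF[] : ∀ {P χ} → IsIndicator P χ → P 1 → ∀ {m} → 1 ≤ m →
                HasCard (InF[ P ] (suc m)) (pairCount χ m + 1)
hasCard-InF[] {P} χ-ind P1 {m} 1≤m = hasCard-≐ (InF-decomposition {P} P1 1≤m)
  (hasCard-∪ (Image⊥last {P})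
             (hasCard-Image _ (yvec-injectiveOn-Pairs {P}) (hasCard-Pairs χ-ind m))
             (hasCard-｛｝ _))

U-indicator : IsIndicator U (λ _ → 1)
U-indicator _ = inj₁ (refl , _)

-- (2 + d) % 2 computes to d % 2, so parity facts follow by two-step recursion.
odd-indicator : IsIndicator (λ d → d % 2 ≡ 1) (_% 2)
odd-indicator zero = inj₂ (refl , λ ())
odd-indicator (suc zero) = inj₁ (refl , refl)
odd-indicator (suc (suc d)) = odd-indicator d

pairCount-U : ∀ j → 2 * pairCount (λ _ → 1) j + j ≡ j * j
pairCount-U zero = refl
pairCount-U (suc j) = begin
  2 * (diffCount (λ _ → 1) j + pairCount (λ _ → 1) j) + suc j ≡⟨ cong (λ d → 2 * (d + q) + suc j) (diffCount-U j) ⟩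
  2 * (j + q) + suc j                                          ≡⟨ expand j q ⟩
  (2 * q + j) + (2 * j + 1)                                    ≡⟨ cong (_+ (2 * j + 1)) (pairCount-U j) ⟩
  j * j + (2 * j + 1)                                          ≡⟨ solve (j ∷ []) ⟩
  suc j * suc j                                                ∎
  where
  open ≡-Reasoning
  q : ℕ
  q = pairCount (λ _ → 1) j
  expand : ∀ j q → 2 * (j + q) + suc j ≡ (2 * q + j) + (2 * j + 1)
  expand = solve-∀
  diffCount-U : ∀ j → diffCount (λ _ → 1) j ≡ j
  diffCount-U zero = refl
  diffCount-U (suc j) = cong suc (diffCount-U j)

%2+[1+n]%2≡1 : ∀ n → n % 2 + suc n % 2 ≡ 1
%2+[1+n]%2≡1 zero = refl
%2+[1+n]%2≡1 (suc zero) = refl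
%2+[1+n]%2≡1 (suc (suc n)) = %2+[1+n]%2≡1 n

diffCount-%2 : ∀ j → diffCount (_% 2) j ≡ ⌈ j /2⌉
diffCount-%2 zero = refl
diffCount-%2 (suc zero) = refl
diffCount-%2 (suc (suc j)) = begin
  j % 2 + (suc j % 2 + diffCount (_% 2) j) ≡⟨ +-assoc (j % 2) _ _ ⟨
  (j % 2 + suc j % 2) + diffCount (_% 2) j ≡⟨ cong₂ _+_ (%2+[1+n]%2≡1 j) (diffCount-%2 j) ⟩
  suc ⌈ j /2⌉                              ∎
  where open ≡-Reasoning

pairCount-%2 : ∀ j → pairCount (_% 2) j ≡ ⌊ j /2⌋ * ⌈ j /2⌉
pairCount-%2 zero = refl
pairCount-%2 (suc j) = begin
  diffCount (_% 2) j + pairCount (_% 2) j ≡⟨ cong₂ _+_ (diffCount-%2 j) (pairCount-%2 j) ⟩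
  ⌈ j /2⌉ + ⌊ j /2⌋ * ⌈ j /2⌉             ≡⟨ factor ⌊ j /2⌋ ⌈ j /2⌉ ⟩
  ⌈ j /2⌉ * suc ⌊ j /2⌋                   ∎
  where
  open ≡-Reasoning
  factor : ∀ h c → c + h * c ≡ c * suc h
  factor = solve-∀

4*⌊n/2⌋*⌈n/2⌉+n%2≡n*n : ∀ n → 4 * (⌊ n /2⌋ * ⌈ n /2⌉) + n % 2 ≡ n * n
4*⌊n/2⌋*⌈n/2⌉+n%2≡n*n zero = refl
4*⌊n/2⌋*⌈n/2⌉+n%2≡n*n (suc zero) = refl
4*⌊n/2⌋*⌈n/2⌉+n%2≡n*n (suc (suc n)) = begin
  4 * (suc h * suc c) + n % 2             ≡⟨ expand h c (n % 2) ⟩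
  (4 * (h * c) + n % 2) + 4 * (h + c) + 4 ≡⟨ cong₂ (λ a b → a + 4 * b + 4)
                                               (4*⌊n/2⌋*⌈n/2⌉+n%2≡n*n n) (⌊n/2⌋+⌈n/2⌉≡n n) ⟩
  n * n + 4 * n + 4                       ≡⟨ solve (n ∷ []) ⟩
  suc (suc n) * suc (suc n)               ∎
  where
  open ≡-Reasoning
  h c : ℕ
  h = ⌊ n /2⌋
  c = ⌈ n /2⌉
  expand : ∀ h c r → 4 * (suc h * suc c) + r ≡ (4 * (h * c) + r) + 4 * (h + c) + 4
  expand = solve-∀

[1+n]%2≡1⇒n%2≡0 : ∀ n → suc n % 2 ≡ 1 → n % 2 ≡ 0
[1+n]%2≡1⇒n%2≡0 zero _ = refl
[1+n]%2≡1⇒n%2≡0 (suc zero) ()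
[1+n]%2≡1⇒n%2≡0 (suc (suc n)) = [1+n]%2≡1⇒n%2≡0 n

[1+n]%2≡0⇒n%2≡1 : ∀ n → suc n % 2 ≡ 0 → n % 2 ≡ 1
[1+n]%2≡0⇒n%2≡1 zero ()
[1+n]%2≡0⇒n%2≡1 (suc zero) _ = refl
[1+n]%2≡0⇒n%2≡1 (suc (suc n)) = [1+n]%2≡0⇒n%2≡1 n

antitone⇒injective : ∀ {A : Set} {_≺_ : A → A → Set} {m} {t : Fin m → A} → (∀ {a} → ¬ (a ≺ a)) →
                     (∀ {i j} → i Fin.< j → t j ≺ t i) → ∀ {i j} → t i ≡ t j → i ≡ j
antitone⇒injective {_≺_ = _≺_} {t = t} irrefl antitone {i} {j} ti≡tj with <-cmp i j
... | tri< i<j _ _ = ⊥-elim (irrefl (subst (t j ≺_) ti≡tj (antitone i<j)))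
... | tri≈ _ i≡j _ = i≡j
... | tri> _ _ j<i = ⊥-elim (irrefl (subst (_≺ t j) ti≡tj (antitone j<i)))

InF[U]≐InF : ∀ {n} → InF[ U ] n ≐ InF n
InF[U]≐InF = (λ (k , ℓ , 1≤k , k<ℓ , ℓ≤n , _ , v≡y) → k , ℓ , 1≤k , k<ℓ , ℓ≤n , v≡y)
           , (λ (k , ℓ , 1≤k , k<ℓ , ℓ≤n , v≡y) → k , ℓ , 1≤k , k<ℓ , ℓ≤n , _ , v≡y)

module _ (m q : ℕ) where

  #F-formula : 2 * q + m ≡ m * m → 2 * (q + 1) + 3 * suc m ≡ suc m * suc m + 4
  #F-formula 2q+m≡m² = begin
    2 * (q + 1) + 3 * suc m   ≡⟨ solve (m ∷ q ∷ []) ⟩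
    (2 * q + m) + (2 * m + 5) ≡⟨ cong (_+ (2 * m + 5)) 2q+m≡m² ⟩
    m * m + (2 * m + 5)       ≡⟨ solve (m ∷ []) ⟩
    suc m * suc m + 4         ∎
    where open ≡-Reasoning

  #F⁺-formula-odd : 4 * q + 0 ≡ m * m → 4 * (q + 1) + 2 * suc m ≡ suc m * suc m + 5
  #F⁺-formula-odd 4q≡m² = begin
    4 * (q + 1) + 2 * suc m   ≡⟨ solve (m ∷ q ∷ []) ⟩
    (4 * q + 0) + (2 * m + 6) ≡⟨ cong (_+ (2 * m + 6)) 4q≡m² ⟩
    m * m + (2 * m + 6)       ≡⟨ solve (m ∷ []) ⟩
    suc m * suc m + 5         ∎
    where open ≡-Reasoning

  #F⁺-formula-even : 4 * q + 1 ≡ m * m → 4 * (q + 1) + 2 * suc m ≡ suc m * suc m + 4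
  #F⁺-formula-even 4q+1≡m² = begin
    4 * (q + 1) + 2 * suc m   ≡⟨ solve (m ∷ q ∷ []) ⟩
    (4 * q + 1) + (2 * m + 5) ≡⟨ cong (_+ (2 * m + 5)) 4q+1≡m² ⟩
    m * m + (2 * m + 5)       ≡⟨ solve (m ∷ []) ⟩
    suc m * suc m + 4         ∎
    where open ≡-Reasoning

  #F⁺×T-formula-odd : 4 * q + 0 ≡ m * m →
                      4 * ((q + 1) * m) + 3 * (suc m * suc m) + 5 ≡ suc m * suc m * suc m + 7 * suc m
  #F⁺×T-formula-odd 4q≡m² = begin
    4 * ((q + 1) * m) + 3 * (suc m * suc m) + 5     ≡⟨ solve (m ∷ q ∷ []) ⟩
    (4 * q + 0) * m + (3 * (m * m) + 10 * m + 8)    ≡⟨ cong (λ x → x * m + (3 * (m * m) + 10 * m + 8)) 4q≡m² ⟩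
    m * m * m + (3 * (m * m) + 10 * m + 8)          ≡⟨ solve (m ∷ []) ⟩
    suc m * suc m * suc m + 7 * suc m               ∎
    where open ≡-Reasoning

  #F⁺×T-formula-even : 4 * q + 1 ≡ m * m →
                       4 * ((q + 1) * m) + 3 * (suc m * suc m) + 4 ≡ suc m * suc m * suc m + 6 * suc m
  #F⁺×T-formula-even 4q+1≡m² = begin
    4 * ((q + 1) * m) + 3 * (suc m * suc m) + 4     ≡⟨ solve (m ∷ q ∷ []) ⟩
    (4 * q + 1) * m + (3 * (m * m) + 9 * m + 7)     ≡⟨ cong (λ x → x * m + (3 * (m * m) + 9 * m + 7)) 4q+1≡m² ⟩
    m * m * m + (3 * (m * m) + 9 * m + 7)           ≡⟨ solve (m ∷ []) ⟩
    suc m * suc m * suc m + 6 * suc m               ∎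
    where open ≡-Reasoning

theorem4p2 : (n : ℕ) → 3 ≤ n →
    -- #𝓕_n = (n² - 3n + 4)/2
    (∃[ m ] (HasCard (InF n) m × 2 * m + 3 * n ≡ n * n + 4))
    -- #𝓕_n^+ = (n² - 2n + 5)/4 (n odd), (n² - 2n + 4)/4 (n even)
    × (n % 2 ≡ 1 → ∃[ m ] (HasCard (InF⁺ n) m × 4 * m + 2 * n ≡ n * n + 5))
    × (n % 2 ≡ 0 → ∃[ m ] (HasCard (InF⁺ n) m × 4 * m + 2 * n ≡ n * n + 4))
    -- #(𝓕_n^+ × 𝓣_n), where 𝓣_n = {t_1 > ... > t_{n-1} > 0} in an arbitrary strictly ordered type
    × ((A : Set) (_<_ : A → A → Set) (0# : A)
       → (∀ {a} → ¬ (a < a)) → (∀ {a b c} → a < b → b < c → a < c)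
       → (t : Fin (n ∸ 1) → A)
       → (∀ {i j} → i Fin.< j → t j < t i)
       → (∀ i → 0# < t i)
       → (n % 2 ≡ 1 → ∃[ m ] (HasCard (λ (p : Vec ℚ n × A) → InF⁺ n (Data.Product.proj₁ p) × ∃[ i ] (Data.Product.proj₂ p ≡ t i)) m
                            × 4 * m + 3 * (n * n) + 5 ≡ n * n * n + 7 * n))
       × (n % 2 ≡ 0 → ∃[ m ] (HasCard (λ (p : Vec ℚ n × A) → InF⁺ n (Data.Product.proj₁ p) × ∃[ i ] (Data.Product.proj₂ p ≡ t i)) m
                            × 4 * m + 3 * (n * n) + 4 ≡ n * n * n + 6 * n)))
theorem4p2 (suc m) (s≤s 1<m) =
    (_ , card-F , #F-formula m (pairCount (λ _ → 1) m) (pairCount-U m))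
  , (λ n-odd → _ , card-F⁺ , #F⁺-formula-odd m q (4q+r≡m² ([1+n]%2≡1⇒n%2≡0 m n-odd)))
  , (λ n-even → _ , card-F⁺ , #F⁺-formula-even m q (4q+r≡m² ([1+n]%2≡0⇒n%2≡1 m n-even)))
  -- Only the injectivity of t enters the count.
  , λ A _≺_ _ irrefl _ t antitone _ →
      let card-F⁺×T = hasCard-⟨×⟩ card-F⁺ (hasCard-range t (antitone⇒injective {_≺_ = _≺_} irrefl antitone))
      in (λ n-odd → _ , card-F⁺×T , #F⁺×T-formula-odd m q (4q+r≡m² ([1+n]%2≡1⇒n%2≡0 m n-odd)))
       , (λ n-even → _ , card-F⁺×T , #F⁺×T-formula-even m q (4q+r≡m² ([1+n]%2≡0⇒n%2≡1 m n-even)))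
  where
  1≤m : 1 ≤ m
  1≤m = <⇒≤ 1<m
  q : ℕ
  q = ⌊ m /2⌋ * ⌈ m /2⌉
  card-F : HasCard (InF (suc m)) (pairCount (λ _ → 1) m + 1)
  card-F = hasCard-≐ InF[U]≐InF (hasCard-InF[] U-indicator _ 1≤m)
  card-F⁺ : HasCard (InF⁺ (suc m)) (q + 1)
  card-F⁺ = subst (λ c → HasCard (InF⁺ (suc m)) (c + 1)) (pairCount-%2 m) (hasCard-InF[] odd-indicator refl 1≤m)
  4q+r≡m² : ∀ {r} → m % 2 ≡ r → 4 * q + r ≡ m * m
  4q+r≡m² refl = 4*⌊n/2⌋*⌈n/2⌉+n%2≡n*n m
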